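{- Let $w$ be an infinite word over a finite alphabet. If $w$ is abelian-square-rich and linearly recurrent, then $w$ is uniformly abelian-square-rich.
   Context: An abelian square is a nonempty word of the form $uv$ where $v$ is an anagram of $u$ (i.e. $u$ and $v$ have the same number of occurrences of each letter). For a finite word $v$, let $\mathrm{AS}(v)$ denote the number of distinct factors of $v$ that are abelian squares. For an infinite word $w$, $p_w(n)$ is the number of distinct factors of $w$ of length $n$, and $\mathrm{Fact}(w)$ the set of its factors. The word $w$ is abelian-square-rich if there exist a constant $C>0$ and an integer $n_0$ such that for every $n\ge n_0$, $\frac{1}{p_w(n)}\sum_{v\in\mathrm{Fact}(w),\,|v|=n}\mathrm{AS}(v)\ge Cn^2$. It is uniformly abelian-square-rich if there exist $C>0$ and $n_0$ such that $\mathrm{AS}(v)\ge C|v|^2$ for every factor $v$ of $w$ with $|v|\ge n_0$. The recurrence index $R_w(n)$ is the least $m$ such that every factor of $w$ of length $m$ contains all factors of $w$ of length $n$ ($+\infty$ if none exists); $w$ is linearly recurrent if $R_w(n)$ is finite for all $n$ and $R_w(n)/n$ is bounded. -}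

module Defs where

open import Data.Nat using (ℕ; zero; suc; _+_; _*_; _∸_; _^_; _≤_; _<_; _≥_)
open import Data.Nat.Properties using () renaming (_≟_ to _≟ℕ_; _≤?_ to _≤?ℕ_)
open import Data.Fin using (Fin; toℕ)
open import Data.Fin.Properties using (any?; all?) renaming (_≟_ to _≟F_)
open import Data.List using (List; []; _∷_; _++_; length; map; upTo; take; drop; filter; deduplicate; concatMap)
open import Data.Nat.ListAction using (sum)
open import Data.List.Properties using (≡-dec)
open import Data.List.Relation.Unary.Unique.Propositional using (Unique)
open import Data.List.Membership.Propositional using (_∈_)
open import Data.Product using (Σ; ∃; _×_; _,_)
open import Relation.Binary.PropositionalEquality using (_≡_)
open import Relation.Nullary using (Dec; yes; no)
open import Relation.Nullary.Decidable using (_×-dec_)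
open import Function.Bundles using (_⇔_)

Word : ℕ → Set
Word k = List (Fin k)

InfWord : ℕ → Set
InfWord k = ℕ → Fin k

window : ∀ {k} → InfWord k → ℕ → ℕ → Word k
window w i n = map (λ j → w (i + j)) (upTo n)

IsFactor : ∀ {k} → InfWord k → Word k → Set
IsFactor w v = ∃ λ i → v ≡ window w i (length v)

IsFactorOf : ∀ {k} → Word k → Word k → Set
IsFactorOf u v = Σ (List _) λ p → Σ (List _) λ s → p ++ u ++ s ≡ v

count : ∀ {k} → Fin k → Word k → ℕ
count a u = length (filter (a ≟F_) u)

Anagram : ∀ {k} → Word k → Word k → Set
Anagram u v = ∀ a → count a u ≡ count a v

IsAbelianSquare : ∀ {k} → Word k → Set
IsAbelianSquare x =
  Σ (Fin (suc (length x))) λ i → (1 ≤ toℕ i) × Anagram (take (toℕ i) x) (drop (toℕ i) x)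

isAbelianSquare? : ∀ {k} (x : Word k) → Dec (IsAbelianSquare x)
isAbelianSquare? x =
  any? (λ i → (1 ≤?ℕ toℕ i) ×-dec all? (λ a → count a (take (toℕ i) x) ≟ℕ count a (drop (toℕ i) x)))

allFactors : ∀ {k} → Word k → List (Word k)
allFactors v =
  concatMap (λ i → map (λ j → take j (drop i v)) (upTo (suc (length v ∸ i))))
            (upTo (suc (length v)))

AS : ∀ {k} → Word k → ℕ
AS v = length (filter isAbelianSquare? (deduplicate (≡-dec _≟F_) (allFactors v)))

-- L is a duplicate-free enumeration of the factors of w of length n
-- (so p_w(n) = length L).
FactorList : ∀ {k} → InfWord k → ℕ → List (Word k) → Set
FactorList w n L = Unique L × (∀ v → (v ∈ L) ⇔ ((length v ≡ n) × IsFactor w v))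

-- Abelian-square-rich, with the constant C > 0 written as a rational a / b
-- (a, b ≥ 1), and the inequality (1/p_w(n)) Σ AS(v) ≥ C n² cleared of denominators.
AbelianSquareRich : ∀ {k} → InfWord k → Set
AbelianSquareRich w =
  Σ ℕ λ a → Σ ℕ λ b → (1 ≤ a) × (1 ≤ b) × Σ ℕ λ n₀ →
    ∀ n → n₀ ≤ n → ∀ L → FactorList w n L →
      a * (n ^ 2) * length L ≤ b * sum (map AS L)

UniformlyAbelianSquareRich : ∀ {k} → InfWord k → Set
UniformlyAbelianSquareRich w =
  Σ ℕ λ a → Σ ℕ λ b → (1 ≤ a) × (1 ≤ b) × Σ ℕ λ n₀ →
    ∀ v → IsFactor w v → n₀ ≤ length v →
      a * (length v ^ 2) ≤ b * AS v

RecurrenceBound : ∀ {k} → InfWord k → ℕ → ℕ → Set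
RecurrenceBound w n m =
  ∀ u → IsFactor w u → length u ≡ m → ∀ v → IsFactor w v → length v ≡ n → IsFactorOf v u

-- Linearly recurrent: R_w(n) finite for all n and R_w(n)/n bounded, i.e. R_w(n) ≤ K n.
LinearlyRecurrent : ∀ {k} → InfWord k → Set
LinearlyRecurrent w = Σ ℕ λ K → ∀ n → Σ ℕ λ m → (m ≤ K * n) × RecurrenceBound w n m

module Submission where

-- Let w be abelian-square-rich (a n² p_w(n) ≤ b Σ AS for n ≥ n₀) and linearly
-- recurrent with constant K, and put d = K + 1.  Take a factor v of length
-- N ≥ d (n₀ + 1) and let n = ⌊N / d⌋, so that n₀ < n, K n ≤ N and N ≤ 2 d n.
-- Linear recurrence gives m ≤ K n ≤ N such that every factor of length m
-- contains every factor of length n; the prefix of v of length m is such a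
-- factor, so every length-n factor z of w is a factor of v and AS z ≤ AS v,
-- because AS is monotone for the factor order.  Averaging AS over an explicit
-- enumeration of the length-n factors, richness yields a n² ≤ b · AS v, and
-- N ≤ 2 d n turns this into a N² ≤ (2d)² b · AS v.

open import Data.Nat using (ℕ; zero; suc; _+_; _*_; _∸_; _^_; _≤_; _<_; z≤n; s≤s; NonZero; >-nonZero)
open import Data.Nat.Properties
open import Data.Nat.DivMod using (_/_; _%_; m≡m%n+[m/n]*n; m%n<n; m/n*n≤m; m*n/n≡m; /-monoˡ-≤)
open import Data.Nat.ListAction using (sum)
open import Data.Nat.Tactic.RingSolver using (solve-∀)
open import Data.Fin using (Fin; zero; suc)
open import Data.Fin.Properties using (injective⇒≤) renaming (_≟_ to _≟F_)
open import Data.List using (List; []; _∷_; _++_; length; map; upTo; applyUpTo; take; drop; filter; deduplicate; lookup)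
open import Data.List.Properties using (≡-dec; ∷-injective; map-upTo; length-applyUpTo; length-take; length-drop; take++drop≡id; ++-assoc; length-++-≤ˡ)
open import Data.List.Membership.Propositional using (_∈_; find; lose)
open import Data.List.Membership.Propositional.Properties using (∈-map⁺; ∈-map⁻; ∈-concatMap⁺; ∈-concatMap⁻; ∈-filter⁺; ∈-filter⁻; ∈-deduplicate⁺; ∈-deduplicate⁻; ∈-upTo⁺; ∈-lookup; ∈-length)
open import Data.List.Membership.Setoid.Properties using (index-injective)
open import Data.List.Relation.Binary.Subset.Propositional using (_⊆_)
open import Data.List.Relation.Unary.Any using (here; there; index)
import Data.List.Relation.Unary.All as All
open import Data.List.Relation.Unary.AllPairs using (_∷_)
open import Data.List.Relation.Unary.Unique.Propositional using (Unique)
import Data.List.Relation.Unary.Unique.Propositional.Properties as Unique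
import Data.List.Relation.Unary.Unique.DecPropositional.Properties as DecUnique
open import Data.Product using (∃; _×_; _,_; proj₂)
open import Data.Empty using (⊥-elim)
open import Function.Definitions using (Injective)
open import Function.Bundles using (mk⇔; Equivalence)
open import Relation.Binary.PropositionalEquality
open import Defs

module _ {A : Set} where

  unique⇒lookup-injective : ∀ {xs : List A} → Unique xs → Injective _≡_ _≡_ (lookup xs)
  unique⇒lookup-injective {_ ∷ _} _          {zero}  {zero}  _  = refl
  unique⇒lookup-injective {_ ∷ _} (x∉ ∷ _)   {zero}  {suc j} eq = ⊥-elim (All.lookup x∉ (∈-lookup j) eq)
  unique⇒lookup-injective {_ ∷ _} (x∉ ∷ _)   {suc i} {zero}  eq = ⊥-elim (All.lookup x∉ (∈-lookup i) (sym eq))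
  unique⇒lookup-injective {_ ∷ _} (_ ∷ uniq) {suc i} {suc j} eq = cong suc (unique⇒lookup-injective uniq eq)

  -- Pigeonhole: sending each position of xs to a position of the same entry in
  -- ys is injective when xs has no duplicates.
  unique-⊆⇒length-≤ : ∀ {xs ys : List A} → Unique xs → xs ⊆ ys → length xs ≤ length ys
  unique-⊆⇒length-≤ {xs} uniq xs⊆ys = injective⇒≤ {f = position} position-injective
    where
    position : Fin (length xs) → Fin _
    position i = index (xs⊆ys (∈-lookup i))

    position-injective : Injective _≡_ _≡_ position
    position-injective eq =
      unique⇒lookup-injective uniq (index-injective (setoid A) (xs⊆ys (∈-lookup _)) (xs⊆ys (∈-lookup _)) eq)

  take-length-++ : ∀ (p r : List A) → take (length p) (p ++ r) ≡ p
  take-length-++ []      r = refl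
  take-length-++ (x ∷ p) r = cong (x ∷_) (take-length-++ p r)

  drop-length-++ : ∀ (p r : List A) → drop (length p) (p ++ r) ≡ r
  drop-length-++ []      r = refl
  drop-length-++ (x ∷ p) r = drop-length-++ p r

module _ {k : ℕ} where

  IsFactorOf-trans : ∀ {x u v : Word k} → IsFactorOf x u → IsFactorOf u v → IsFactorOf x v
  IsFactorOf-trans {x} (p , s , refl) (p′ , s′ , refl) = p′ ++ p , s ++ s′ ,
    (begin
      (p′ ++ p) ++ x ++ s ++ s′    ≡⟨ ++-assoc p′ p (x ++ s ++ s′) ⟩
      p′ ++ p ++ x ++ s ++ s′      ≡⟨ cong (λ t → p′ ++ p ++ t) (sym (++-assoc x s s′)) ⟩
      p′ ++ p ++ (x ++ s) ++ s′    ≡⟨ cong (p′ ++_) (sym (++-assoc p (x ++ s) s′)) ⟩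
      p′ ++ (p ++ x ++ s) ++ s′    ∎)
    where open ≡-Reasoning

  private
    factorsFrom : Word k → ℕ → List (Word k)
    factorsFrom v i = map (λ j → take j (drop i v)) (upTo (suc (length v ∸ i)))

  ∈allFactors⇒IsFactorOf : ∀ {x v : Word k} → x ∈ allFactors v → IsFactorOf x v
  ∈allFactors⇒IsFactorOf {x} {v} x∈ with find (∈-concatMap⁻ (factorsFrom v) {xs = upTo (suc (length v))} x∈)
  ... | i , _ , x∈from with ∈-map⁻ (λ j → take j (drop i v)) {xs = upTo (suc (length v ∸ i))} x∈from
  ... | j , _ , refl = take i v , drop j (drop i v) ,
    (begin
      take i v ++ take j (drop i v) ++ drop j (drop i v)   ≡⟨ cong (take i v ++_) (take++drop≡id j (drop i v)) ⟩
      take i v ++ drop i v                                   ≡⟨ take++drop≡id i v ⟩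
      v                                                      ∎)
    where open ≡-Reasoning

  IsFactorOf⇒∈allFactors : ∀ {x v : Word k} → IsFactorOf x v → x ∈ allFactors v
  IsFactorOf⇒∈allFactors {x} (p , s , refl) =
    ∈-concatMap⁺ (factorsFrom v) (lose (∈-upTo⁺ (s≤s (length-++-≤ˡ p))) x∈from)
    where
    v : Word k
    v = p ++ x ++ s

    x≡start : take (length x) (drop (length p) v) ≡ x
    x≡start = trans (cong (take (length x)) (drop-length-++ p (x ++ s))) (take-length-++ x s)

    x-fits : length x ≤ length v ∸ length p
    x-fits = subst (length x ≤_) (trans (cong length (sym (drop-length-++ p (x ++ s)))) (length-drop (length p) v))
                   (length-++-≤ˡ x)

    x∈from : x ∈ factorsFrom v (length p)
    x∈from = subst (_∈ factorsFrom v (length p)) x≡start (∈-map⁺ _ (∈-upTo⁺ (s≤s x-fits)))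

  abelianSquareFactors : Word k → List (Word k)
  abelianSquareFactors v = filter isAbelianSquare? (deduplicate (≡-dec _≟F_) (allFactors v))

  -- Every abelian-square factor of u is one of v, and these lists have no duplicates.
  AS-mono : ∀ {u v : Word k} → IsFactorOf u v → AS u ≤ AS v
  AS-mono {u} {v} u⊑v = unique-⊆⇒length-≤ uniq sub
    where
    uniq : Unique (abelianSquareFactors u)
    uniq = Unique.filter⁺ isAbelianSquare? (DecUnique.deduplicate-! (≡-dec _≟F_) (allFactors u))

    sub : abelianSquareFactors u ⊆ abelianSquareFactors v
    sub z∈ with ∈-filter⁻ isAbelianSquare? {xs = deduplicate (≡-dec _≟F_) (allFactors u)} z∈
    ... | z∈factors , square = ∈-filter⁺ isAbelianSquare? (∈-deduplicate⁺ (≡-dec _≟F_)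
      (IsFactorOf⇒∈allFactors (IsFactorOf-trans (∈allFactors⇒IsFactorOf (∈-deduplicate⁻ (≡-dec _≟F_) (allFactors u) z∈factors)) u⊑v))) square

module _ {A : Set} where

  take-applyUpTo : ∀ (f : ℕ → A) {m N} → m ≤ N → take m (applyUpTo f N) ≡ applyUpTo f m
  take-applyUpTo f {zero}          _         = refl
  take-applyUpTo f {suc m} {suc N} (s≤s m≤N) = cong (f 0 ∷_) (take-applyUpTo (λ j → f (suc j)) m≤N)

  prefix-of-applyUpTo : ∀ (f : ℕ → A) v s {m} → v ++ s ≡ applyUpTo f m → v ≡ applyUpTo f (length v)
  prefix-of-applyUpTo f []      s          _  = refl
  prefix-of-applyUpTo f (x ∷ v) s {suc m} eq with ∷-injective eq
  ... | x≡ , rest≡ = cong₂ _∷_ x≡ (prefix-of-applyUpTo (λ j → f (suc j)) v s rest≡)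

  infix-of-applyUpTo : ∀ (f : ℕ → A) p v s {m} →
    p ++ v ++ s ≡ applyUpTo f m → v ≡ applyUpTo (λ j → f (length p + j)) (length v)
  infix-of-applyUpTo f []      v s         eq = prefix-of-applyUpTo f v s eq
  infix-of-applyUpTo f (x ∷ p) v s {suc m} eq =
    infix-of-applyUpTo (λ j → f (suc j)) p v s (proj₂ (∷-injective eq))

module _ {k : ℕ} (w : InfWord k) where

  window≡applyUpTo : ∀ i n → window w i n ≡ applyUpTo (λ j → w (i + j)) n
  window≡applyUpTo i n = map-upTo (λ j → w (i + j)) n

  length-window : ∀ i n → length (window w i n) ≡ n
  length-window i n = trans (cong length (window≡applyUpTo i n)) (length-applyUpTo _ n)

  window⇒IsFactor : ∀ {v} i n → v ≡ window w i n → IsFactor w v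
  window⇒IsFactor i n v≡ = i , trans v≡ (cong (window w i) (sym (trans (cong length v≡) (length-window i n))))

  prefix-IsFactor : ∀ {v} m → IsFactor w v → m ≤ length v → IsFactor w (take m v)
  prefix-IsFactor {v} m (i , v≡) m≤ = window⇒IsFactor i m
    (begin
      take m v                                           ≡⟨ cong (take m) v≡ ⟩
      take m (window w i (length v))                     ≡⟨ cong (take m) (window≡applyUpTo i (length v)) ⟩
      take m (applyUpTo (λ j → w (i + j)) (length v))    ≡⟨ take-applyUpTo _ m≤ ⟩
      applyUpTo (λ j → w (i + j)) m                      ≡⟨ sym (window≡applyUpTo i m) ⟩
      window w i m                                       ∎)
    where open ≡-Reasoning

  factor-of-prefix : ∀ {z} m → IsFactorOf z (window w 0 m) → ∃ λ j → j ≤ m × z ≡ window w j (length z)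
  factor-of-prefix {z} m (p , s , eq) = length p , p-fits ,
    trans (infix-of-applyUpTo w p z s (trans eq (window≡applyUpTo 0 m)))
          (sym (window≡applyUpTo (length p) (length z)))
    where
    p-fits : length p ≤ m
    p-fits = subst (length p ≤_) (trans (cong length eq) (length-window 0 m)) (length-++-≤ˡ p)

  earlyFactors : ℕ → ℕ → List (Word k)
  earlyFactors n m = deduplicate (≡-dec _≟F_) (map (λ j → window w j n) (upTo (suc m)))

  -- If every length-m factor contains every length-n factor, then (applied to
  -- the prefix of length m) every length-n factor already occurs at some j ≤ m.
  earlyFactors-enumerates : ∀ {n m} → RecurrenceBound w n m → FactorList w n (earlyFactors n m)
  earlyFactors-enumerates {n} {m} bound =
    DecUnique.deduplicate-! (≡-dec _≟F_) (map window-at (upTo (suc m))) , λ z → mk⇔ sound complete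
    where
    window-at : ℕ → Word k
    window-at j = window w j n

    sound : ∀ {z} → z ∈ earlyFactors n m → (length z ≡ n) × IsFactor w z
    sound z∈ with ∈-map⁻ window-at {xs = upTo (suc m)} (∈-deduplicate⁻ (≡-dec _≟F_) (map window-at (upTo (suc m))) z∈)
    ... | j , _ , z≡ = trans (cong length z≡) (length-window j n) , window⇒IsFactor j n z≡

    complete : ∀ {z} → (length z ≡ n) × IsFactor w z → z ∈ earlyFactors n m
    complete {z} (refl , z-factor)
      with factor-of-prefix m (bound (window w 0 m) (window⇒IsFactor 0 m refl) (length-window 0 m) z z-factor refl)
    ... | j , j≤m , z≡ =
      ∈-deduplicate⁺ (≡-dec _≟F_) (subst (_∈ map window-at (upTo (suc m))) (sym z≡) (∈-map⁺ window-at (∈-upTo⁺ (s≤s j≤m))))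

  long-factor-contains : ∀ {n m v z} → RecurrenceBound w n m → IsFactor w v → m ≤ length v →
                         IsFactor w z → length z ≡ n → IsFactorOf z v
  long-factor-contains {m = m} {v} bound v-factor m≤ z-factor z-length =
    IsFactorOf-trans (bound (take m v) (prefix-IsFactor m v-factor m≤) prefix-length _ z-factor z-length)
                     ([] , drop m v , take++drop≡id m v)
    where
    prefix-length : length (take m v) ≡ m
    prefix-length = trans (length-take m v) (m≤n⇒m⊓n≡m m≤)

sum-map-≤ : ∀ {A : Set} (f : A → ℕ) (L : List A) {c} → (∀ {z} → z ∈ L → f z ≤ c) → sum (map f L) ≤ length L * c
sum-map-≤ f []      bounded = z≤n
sum-map-≤ f (z ∷ L) bounded = +-mono-≤ (bounded (here refl)) (sum-map-≤ f L (λ z∈ → bounded (there z∈)))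

average-bound : ∀ {A : Set} (f : A → ℕ) (L : List A) {x b c} → 0 < length L →
                (∀ {z} → z ∈ L → f z ≤ c) → x * length L ≤ b * sum (map f L) → x ≤ b * c
average-bound f L {x} {b} {c} nonempty bounded average =
  *-cancelʳ-≤ x (b * c) (length L) {{>-nonZero nonempty}} (begin
    x * length L          ≤⟨ average ⟩
    b * sum (map f L)     ≤⟨ *-monoʳ-≤ b (sum-map-≤ f L bounded) ⟩
    b * (length L * c)    ≡⟨ cong (b *_) (*-comm (length L) c) ⟩
    b * (c * length L)    ≡⟨ *-assoc b c (length L) ⟨
    b * c * length L      ∎)
  where open ≤-Reasoning

-- Richness at a single length n bounds AS v from below for every factor v that
-- is long enough to contain all length-n factors: each of them has at most AS v
-- abelian-square factors, so the average over them does too.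
rich⇒AS-bound : ∀ {k} (w : InfWord k) {a b n m v} →
  (∀ L → FactorList w n L → a * n ^ 2 * length L ≤ b * sum (map AS L)) →
  RecurrenceBound w n m → IsFactor w v → m ≤ length v → a * n ^ 2 ≤ b * AS v
rich⇒AS-bound w {a} {b} {n} {m} {v} rich bound v-factor m≤ =
  average-bound AS L {a * n ^ 2} {b} (∈-length first-window∈L) bounded (rich L listing)
  where
  L : List (Word _)
  L = earlyFactors w n m

  listing : FactorList w n L
  listing = earlyFactors-enumerates w bound

  first-window∈L : window w 0 n ∈ L
  first-window∈L = Equivalence.from (proj₂ listing _) (length-window w 0 n , window⇒IsFactor w 0 n refl)

  bounded : ∀ {z} → z ∈ L → AS z ≤ AS v
  bounded z∈ with Equivalence.to (proj₂ listing _) z∈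
  ... | z-length , z-factor = AS-mono (long-factor-contains w bound v-factor m≤ z-factor z-length)

module _ (N d : ℕ) .{{_ : NonZero d}} where

  quotient-≥ : ∀ {q} → q * d ≤ N → q ≤ N / d
  quotient-≥ {q} q*d≤N = subst (_≤ N / d) (m*n/n≡m q d) (/-monoˡ-≤ d q*d≤N)

  -- N < (⌊N/d⌋ + 1) d, so N ≤ 2 d ⌊N/d⌋ as soon as ⌊N/d⌋ ≥ 1.
  ≤-twice-quotient : 1 ≤ N / d → N ≤ 2 * d * (N / d)
  ≤-twice-quotient 1≤n = begin
    N                          ≡⟨ m≡m%n+[m/n]*n N d ⟩
    N % d + N / d * d          ≤⟨ +-monoˡ-≤ (N / d * d) (<⇒≤ (m%n<n N d)) ⟩
    d + N / d * d              ≡⟨ cong (_+ N / d * d) (*-identityˡ d) ⟨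
    1 * d + N / d * d          ≤⟨ +-monoˡ-≤ (N / d * d) (*-monoˡ-≤ d 1≤n) ⟩
    N / d * d + N / d * d      ≡⟨ double (N / d) d ⟩
    2 * d * (N / d)            ∎
    where
    open ≤-Reasoning
    double : ∀ n d → n * d + n * d ≡ 2 * d * n
    double = solve-∀

square-scaling : ∀ {a N n} D {y} → N ≤ D * n → a * n ^ 2 ≤ y → a * N ^ 2 ≤ D * D * y
square-scaling {a} {N} {n} D {y} N≤Dn an²≤y = begin
  a * N ^ 2               ≤⟨ *-monoʳ-≤ a (^-monoˡ-≤ 2 N≤Dn) ⟩
  a * (D * n) ^ 2         ≡⟨ regroup a D n ⟩
  D * D * (a * n ^ 2)     ≤⟨ *-monoʳ-≤ (D * D) an²≤y ⟩
  D * D * y               ∎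
  where
  open ≤-Reasoning
  -- x ^ 2 unfolds to x * (x * 1), which is the form the solver reflects.
  regroup : ∀ a D n → a * ((D * n) * ((D * n) * 1)) ≡ D * D * (a * (n * (n * 1)))
  regroup = solve-∀

-- With d = K + 1, D = 2d and n = ⌊|v| / d⌋ for a factor v of length ≥ d (n₀ + 1):
-- n > n₀, the recurrence bound m ≤ K n fits inside v, and |v| ≤ D n.
lemma2 : ∀ (k : ℕ) (w : InfWord k) → AbelianSquareRich w → LinearlyRecurrent w → UniformlyAbelianSquareRich w
lemma2 k w (a , b , 1≤a , 1≤b , n₀ , rich) (K , linear) =
  a , D * D * b , 1≤a , *-mono-≤ {1} {D * D} (s≤s z≤n) 1≤b , d * suc n₀ , uniform
  where
  d D : ℕ
  d = suc K
  D = 2 * d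

  uniform : ∀ v → IsFactor w v → d * suc n₀ ≤ length v → a * length v ^ 2 ≤ D * D * b * AS v
  uniform v v-factor long with linear (length v / d)
  ... | m , m≤Kn , bound =
    subst (a * N ^ 2 ≤_) (sym (*-assoc (D * D) b (AS v)))
      (square-scaling {a} D (≤-twice-quotient N d (≤-trans (s≤s z≤n) n₀<n))
        (rich⇒AS-bound w {a} {b} (rich n (<⇒≤ n₀<n)) bound v-factor m≤N))
    where
    N n : ℕ
    N = length v
    n = N / d

    n₀<n : n₀ < n
    n₀<n = quotient-≥ N d (subst (_≤ N) (*-comm d (suc n₀)) long)

    m≤N : m ≤ N
    m≤N = begin
      m        ≤⟨ m≤Kn ⟩
      K * n    ≤⟨ *-monoˡ-≤ n (n≤1+n K) ⟩
      d * n    ≡⟨ *-comm d n ⟩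
      n * d    ≤⟨ m/n*n≤m N d ⟩
      N        ∎
      where open ≤-Reasoning
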